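{- Let $G$ be a finite connected graph and $W$ a double trace in $G$. Then $W$ is a strong trace if and only if for every vertex $v$ of $G$ the vertex figure $F_{v,W}$ is a single cycle (i.e. is connected).
   Context: A walk in $G$ is an alternating sequence $W=v_0e_1v_1\ldots v_{\ell-1}e_\ell v_\ell$ of vertices and edges with $e_i$ joining $v_{i-1}$ and $v_i$; it is closed if $v_0=v_\ell$. A double trace is a closed walk that traverses every edge of $G$ exactly twice; indices are taken modulo $\ell$. For a vertex $v$ and $N\subseteq N(v)$ (the set of neighbours of $v$), $W$ has an $N$-repetition at $v$ if for every $i$ with $v_i=v$ we have $v_{i+1}\in N$ if and only if $v_{i-1}\in N$; it is trivial if $N=\emptyset$ or $N=N(v)$. A strong trace is a double trace with no nontrivial repetition at any vertex. For a vertex $v$ with set $E(v)$ of incident edges, the vertex figure $F_{v,W}$ is the $2$-regular multigraph (loops and parallel edges allowed) with vertex set $E(v)$ in which, for each occurrence $v_i=v$ in $W$, an edge is placed between $e_i$ and $e_{i+1}$ (the edges consecutive along $W$ at that passage through $v$). -}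

module Defs where

open import Data.Nat using (ℕ; zero; suc; _+_)
open import Data.Nat.DivMod using (_mod_)
open import Data.Fin using (Fin; toℕ)
open import Data.Fin.Subset using (Subset; _∈_; _∉_)
open import Data.Product using (Σ; _×_; _,_; proj₁; proj₂; ∃-syntax)
open import Data.Sum using (_⊎_)
open import Relation.Nullary using (¬_)
open import Relation.Binary.PropositionalEquality using (_≡_; _≢_)
open import Function.Bundles using (_⇔_)

record Graph : Set where
  field
    n     : ℕ
    m     : ℕ
    ends  : Fin m → Fin n × Fin n
    loopless : ∀ e → proj₁ (ends e) ≢ proj₂ (ends e)
    simple   : ∀ e f → ( (proj₁ (ends e) ≡ proj₁ (ends f) × proj₂ (ends e) ≡ proj₂ (ends f))
                       ⊎ (proj₁ (ends e) ≡ proj₂ (ends f) × proj₂ (ends e) ≡ proj₁ (ends f)) )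
                     → e ≡ f

module _ (G : Graph) where
  open Graph G

  Joins : Fin m → Fin n → Fin n → Set
  Joins e u w = (proj₁ (ends e) ≡ u × proj₂ (ends e) ≡ w)
              ⊎ (proj₁ (ends e) ≡ w × proj₂ (ends e) ≡ u)

  Adj : Fin n → Fin n → Set
  Adj u w = ∃[ e ] Joins e u w

  Incident : Fin n → Fin m → Set
  Incident v e = proj₁ (ends e) ≡ v ⊎ proj₂ (ends e) ≡ v

  data Reach : Fin n → Fin n → Set where
    here : ∀ {u} → Reach u u
    step : ∀ {u w x} → Adj u w → Reach w x → Reach u x

  Connected : Set
  Connected = ∀ u w → Reach u w

next : ∀ {k} → Fin (suc k) → Fin (suc k)
next {k} i = suc (toℕ i) mod suc k

prev : ∀ {k} → Fin (suc k) → Fin (suc k)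
prev {k} i = (toℕ i + k) mod suc k

-- A closed walk v_0 e_1 v_1 … e_ℓ v_ℓ (v_ℓ = v_0) of length ℓ = suc len,
-- stored cyclically: vtx i = v_i, edg i = e_i (indices mod ℓ), where
-- e_i joins v_{i-1} and v_i.
record ClosedWalk (G : Graph) : Set where
  open Graph G
  field
    len   : ℕ
    vtx   : Fin (suc len) → Fin n
    edg   : Fin (suc len) → Fin m
    joins : ∀ i → Joins G (edg i) (vtx (prev i)) (vtx i)

module _ {G : Graph} (W : ClosedWalk G) where
  open Graph G
  open ClosedWalk W

  DoubleTrace : Set
  DoubleTrace = ∀ e → Σ (Fin (suc len)) λ i → Σ (Fin (suc len)) λ j →
                  i ≢ j × edg i ≡ e × edg j ≡ e × (∀ k → edg k ≡ e → k ≡ i ⊎ k ≡ j)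

  -- N-repetition at v (N ⊆ N(v) is required separately)
  Repetition : Fin n → Subset n → Set
  Repetition v N = ∀ i → vtx i ≡ v → (vtx (next i) ∈ N ⇔ vtx (prev i) ∈ N)

  Trivial : Fin n → Subset n → Set
  Trivial v N = (∀ x → x ∉ N) ⊎ (∀ x → (x ∈ N ⇔ Adj G v x))

  StrongTrace : Set
  StrongTrace = DoubleTrace × (∀ v (N : Subset n) → (∀ x → x ∈ N → Adj G v x)
                                 → Repetition v N → Trivial v N)

  -- Vertex figure F_{v,W}: vertex set E(v); for each i with v_i = v an edge
  -- between e_i and e_{i+1}.  FigEdge v a b: some such edge joins a and b.
  FigEdge : Fin n → Fin m → Fin m → Set
  FigEdge v a b = ∃[ i ] (vtx i ≡ v × ((edg i ≡ a × edg (next i) ≡ b) ⊎ (edg i ≡ b × edg (next i) ≡ a)))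

  data FigReach (v : Fin n) : Fin m → Fin m → Set where
    here : ∀ {a} → FigReach v a a
    step : ∀ {a b c} → FigEdge v a b → FigReach v b c → FigReach v a c

  FigureConnected : Fin n → Set
  FigureConnected v = ∀ a b → Incident G v a → Incident G v b → FigReach v a b

-- At a vertex v, an edge c of the figure and the neighbour x with c joining v and x
-- determine each other, so subsets N of N(v) correspond to sets C of edges at v.
-- Under this correspondence W has an N-repetition at v exactly when C is closed
-- under the figure edges, since the passage through v at position i pairs e_i
-- (towards v_{i-1}) with e_{i+1} (towards v_{i+1}).  Closed sets of edges are
-- unions of components of F_{v,W}, and they are only the trivial ones precisely
-- when F_{v,W} is connected.
module Submission where

open import Level using (0ℓ)
open import Data.Nat using (ℕ; zero; suc; _+_; _≤_; z≤n; s≤s; _%_)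
open import Data.Nat.Properties using (≤-trans; +-suc; 1+n≰n)
open import Data.Nat.DivMod using (%-distribˡ-+; m%n<n; m%n%n≡m%n; [m+n]%n≡m%n; m<n⇒m%n≡m)
open import Data.Fin using (Fin; toℕ)
open import Data.Fin.Properties using (toℕ-injective; toℕ-fromℕ<; toℕ<n; any?; _≟_)
open import Data.Fin.Subset using (Subset; _∈_; _⊂_; ∣_∣)
open import Data.Fin.Subset.Properties using (_∈?_; p⊂q⇒∣p∣<∣q∣; ∣p∣≤n)
open import Data.Vec using (tabulate)
open import Data.Vec.Properties using (lookup∘tabulate; []=⇒lookup; lookup⇒[]=)
open import Data.Product using (_×_; _,_; proj₁; proj₂; ∃; ∃-syntax)
open import Data.Sum using (_⊎_; [_,_]′; inj₁; inj₂)
open import Data.Empty using (⊥-elim)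
open import Function using (_∘_; _$_)
open import Function.Bundles using (_⇔_; mk⇔; Equivalence)
open import Function.Construct.Symmetry using (⇔-sym)
open import Function.Construct.Composition using (_⇔-∘_)
open import Relation.Nullary using (Dec; yes; no; does)
open import Relation.Nullary.Decidable using (_×-dec_; _⊎-dec_; ¬?; map′)
open import Relation.Unary using (Pred; Decidable)
open import Relation.Binary using (Rel)
import Relation.Binary as B
open import Relation.Binary.Construct.Closure.ReflexiveTransitive using (Star; ε; _◅_; _◅◅_)
open import Relation.Binary.PropositionalEquality using (_≡_; refl; sym; trans; cong; subst; module ≡-Reasoning)
open import Defs

open Equivalence using (to; from)

[m%n+o]%n≡[m+o]%n : ∀ m o n → (m % suc n + o) % suc n ≡ (m + o) % suc n
[m%n+o]%n≡[m+o]%n m o n = begin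
  (m % suc n + o) % suc n                   ≡⟨ %-distribˡ-+ (m % suc n) o (suc n) ⟩
  (m % suc n % suc n + o % suc n) % suc n   ≡⟨ cong (λ t → (t + o % suc n) % suc n) (m%n%n≡m%n m (suc n)) ⟩
  (m % suc n + o % suc n) % suc n           ≡⟨ %-distribˡ-+ m o (suc n) ⟨
  (m + o) % suc n                           ∎
  where open ≡-Reasoning

prev-next : ∀ {k} (i : Fin (suc k)) → prev (next i) ≡ i
prev-next {k} i = toℕ-injective (begin
  toℕ (prev (next i))               ≡⟨ toℕ-fromℕ< _ ⟩
  (toℕ (next i) + k) % suc k        ≡⟨ cong (λ t → (t + k) % suc k) (toℕ-fromℕ< (m%n<n (suc (toℕ i)) (suc k))) ⟩
  (suc (toℕ i) % suc k + k) % suc k ≡⟨ [m%n+o]%n≡[m+o]%n (suc (toℕ i)) k k ⟩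
  (suc (toℕ i) + k) % suc k         ≡⟨ cong (_% suc k) (+-suc (toℕ i) k) ⟨
  (toℕ i + suc k) % suc k           ≡⟨ [m+n]%n≡m%n (toℕ i) (suc k) ⟩
  toℕ i % suc k                     ≡⟨ m<n⇒m%n≡m (toℕ<n i) ⟩
  toℕ i                             ∎)
  where open ≡-Reasoning

module _ {m} {P : Pred (Fin m) 0ℓ} where

  toSubset : Decidable P → Subset m
  toSubset P? = tabulate (does ∘ P?)

  ∈toSubset⁺ : (P? : Decidable P) → ∀ {x} → P x → x ∈ toSubset P?
  ∈toSubset⁺ P? {x} px with P? x in eq
  ... | yes _  = lookup⇒[]= x (toSubset P?) (trans (lookup∘tabulate (does ∘ P?) x) (cong does eq))
  ... | no ¬px = ⊥-elim (¬px px)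

  ∈toSubset⁻ : (P? : Decidable P) → ∀ {x} → x ∈ toSubset P? → P x
  ∈toSubset⁻ P? {x} x∈ with P? x | trans (sym (lookup∘tabulate (does ∘ P?) x)) ([]=⇒lookup x∈)
  ... | yes px | _ = px
  ... | no _   | ()

module _ {m} {E : Rel (Fin m) 0ℓ} (E? : B.Decidable E) (a : Fin m) where

  WithinSteps : ℕ → Pred (Fin m) 0ℓ
  WithinSteps zero    c = a ≡ c
  WithinSteps (suc k) c = WithinSteps k c ⊎ ∃[ d ] (WithinSteps k d × E d c)

  WithinSteps? : ∀ k → Decidable (WithinSteps k)
  WithinSteps? zero    c = a ≟ c
  WithinSteps? (suc k) c = WithinSteps? k c ⊎-dec any? (λ d → WithinSteps? k d ×-dec E? d c)

  WithinSteps-start : ∀ k → WithinSteps k a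
  WithinSteps-start zero    = refl
  WithinSteps-start (suc k) = inj₁ (WithinSteps-start k)

  WithinSteps⇒Star : ∀ k {c} → WithinSteps k c → Star E a c
  WithinSteps⇒Star zero    refl              = ε
  WithinSteps⇒Star (suc k) (inj₁ w)          = WithinSteps⇒Star k w
  WithinSteps⇒Star (suc k) (inj₂ (_ , w , e)) = WithinSteps⇒Star k w ◅◅ (e ◅ ε)

  -- The balls around a grow strictly until they saturate, so some ball of radius
  -- at most m is saturated and then contains everything reachable from a.
  Saturated : ℕ → Set
  Saturated k = ∀ {c} → WithinSteps (suc k) c → WithinSteps k c

  ball : ℕ → Subset m
  ball k = toSubset (WithinSteps? k)

  saturated-or-grows : ∀ k → Saturated k ⊎ ball k ⊂ ball (suc k)
  saturated-or-grows k with any? (λ c → WithinSteps? (suc k) c ×-dec ¬? (WithinSteps? k c))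
  ... | yes (c , new , ¬old) =
    inj₂ ( (∈toSubset⁺ (WithinSteps? (suc k)) ∘ inj₁ ∘ ∈toSubset⁻ (WithinSteps? k))
         , c , ∈toSubset⁺ (WithinSteps? (suc k)) new , ¬old ∘ ∈toSubset⁻ (WithinSteps? k))
  ... | no ∄new = inj₁ λ {c} w → saturate c w
    where
      saturate : ∀ c → WithinSteps (suc k) c → WithinSteps k c
      saturate c w with WithinSteps? k c
      ... | yes old = old
      ... | no ¬old = ⊥-elim (∄new (c , w , ¬old))

  saturated-or-large : ∀ k → ∃ Saturated ⊎ k ≤ ∣ ball k ∣
  saturated-or-large zero = inj₂ z≤n
  saturated-or-large (suc k) with saturated-or-large k | saturated-or-grows k
  ... | inj₁ sat | _          = inj₁ sat
  ... | inj₂ _   | inj₁ sat   = inj₁ (k , sat)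
  ... | inj₂ k≤  | inj₂ grows = inj₂ (≤-trans (s≤s k≤) (p⊂q⇒∣p∣<∣q∣ grows))

  eventually-saturated : ∃ Saturated
  eventually-saturated with saturated-or-large (suc m)
  ... | inj₁ sat = sat
  ... | inj₂ m<m = ⊥-elim (1+n≰n (≤-trans m<m (∣p∣≤n (ball (suc m)))))

  Star⇒WithinSteps : ∀ {k} → Saturated k → ∀ {x c} → WithinSteps k x → Star E x c → WithinSteps k c
  Star⇒WithinSteps sat w ε       = w
  Star⇒WithinSteps sat w (e ◅ s) = Star⇒WithinSteps sat (sat (inj₂ (_ , w , e))) s

  Star? : Decidable (Star E a)
  Star? c with eventually-saturated
  ... | K , sat = map′ (WithinSteps⇒Star K) (Star⇒WithinSteps sat (WithinSteps-start K)) (WithinSteps? K c)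

module _ {G : Graph} where
  open Graph G

  Joins-sym : ∀ {e u w} → Joins G e u w → Joins G e w u
  Joins-sym (inj₁ (p , q)) = inj₂ (p , q)
  Joins-sym (inj₂ (p , q)) = inj₁ (p , q)

  Joins-end-unique : ∀ {e v x y} → Joins G e v x → Joins G e v y → x ≡ y
  Joins-end-unique (inj₁ (p , q)) (inj₁ (p' , q')) = trans (sym q) q'
  Joins-end-unique (inj₂ (p , q)) (inj₂ (p' , q')) = trans (sym p) p'
  Joins-end-unique (inj₁ (p , q)) (inj₂ (p' , q')) = trans (sym q) (trans q' (trans (sym p) p'))
  Joins-end-unique (inj₂ (p , q)) (inj₁ (p' , q')) = trans (sym p) (trans p' (trans (sym q) q'))

  Joins-edge-unique : ∀ {e f v x} → Joins G e v x → Joins G f v x → e ≡ f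
  Joins-edge-unique (inj₁ (p , q)) (inj₁ (p' , q')) = simple _ _ (inj₁ (trans p (sym p') , trans q (sym q')))
  Joins-edge-unique (inj₂ (p , q)) (inj₂ (p' , q')) = simple _ _ (inj₁ (trans p (sym p') , trans q (sym q')))
  Joins-edge-unique (inj₁ (p , q)) (inj₂ (p' , q')) = simple _ _ (inj₂ (trans p (sym q') , trans q (sym p')))
  Joins-edge-unique (inj₂ (p , q)) (inj₁ (p' , q')) = simple _ _ (inj₂ (trans p (sym q') , trans q (sym p')))

  Joins? : ∀ e u w → Dec (Joins G e u w)
  Joins? e u w = ((proj₁ (ends e) ≟ u) ×-dec (proj₂ (ends e) ≟ w))
               ⊎-dec ((proj₁ (ends e) ≟ w) ×-dec (proj₂ (ends e) ≟ u))

  Incident⇒Joins : ∀ {v a} → Incident G v a → ∃ (Joins G a v)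
  Incident⇒Joins (inj₁ p) = _ , inj₁ (p , refl)
  Incident⇒Joins (inj₂ p) = _ , inj₂ (refl , p)

  Joins⇒Incident : ∀ {v a x} → Joins G a v x → Incident G v a
  Joins⇒Incident (inj₁ (p , _)) = inj₁ p
  Joins⇒Incident (inj₂ (_ , p)) = inj₂ p

  Corresponds : Fin n → Subset n → Pred (Fin m) 0ℓ → Set
  Corresponds v N C = ∀ {c x} → Joins G c v x → (x ∈ N ⇔ C c)

  EdgesInto : Fin n → Subset n → Pred (Fin m) 0ℓ
  EdgesInto v N c = ∃[ x ] (Joins G c v x × x ∈ N)

  EdgesInto-corresponds : ∀ {v N} → Corresponds v N (EdgesInto v N)
  EdgesInto-corresponds {N = N} jx = mk⇔
    (λ x∈N → _ , jx , x∈N)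
    (λ (y , jy , y∈N) → subst (_∈ N) (Joins-end-unique jy jx) y∈N)

  FarEnd : Fin n → Pred (Fin m) 0ℓ → Pred (Fin n) 0ℓ
  FarEnd v C x = ∃[ c ] (Joins G c v x × C c)

  FarEnd? : ∀ {C} v → Decidable C → Decidable (FarEnd v C)
  FarEnd? v C? x = any? (λ c → Joins? c v x ×-dec C? c)

  farEnds : ∀ {C} → Fin n → Decidable C → Subset n
  farEnds v C? = toSubset (FarEnd? v C?)

  farEnds⊆neighbours : ∀ {C} v (C? : Decidable C) x → x ∈ farEnds v C? → Adj G v x
  farEnds⊆neighbours v C? x x∈ with ∈toSubset⁻ (FarEnd? v C?) x∈
  ... | c , jc , _ = c , jc

  farEnds-corresponds : ∀ {C} v (C? : Decidable C) → Corresponds v (farEnds v C?) C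
  farEnds-corresponds {C} v C? jx = mk⇔
    (λ x∈ → let (c , jc , Cc) = ∈toSubset⁻ (FarEnd? v C?) x∈ in subst C (Joins-edge-unique jc jx) Cc)
    (λ Cc → ∈toSubset⁺ (FarEnd? v C?) (_ , jx , Cc))

  module _ (W : ClosedWalk G) where
    open ClosedWalk W

    Joins-prev : ∀ {i v} → vtx i ≡ v → Joins G (edg i) v (vtx (prev i))
    Joins-prev {i} vi = Joins-sym (subst (Joins G (edg i) (vtx (prev i))) vi (joins i))

    Joins-next : ∀ {i v} → vtx i ≡ v → Joins G (edg (next i)) v (vtx (next i))
    Joins-next {i} vi =
      subst (λ u → Joins G (edg (next i)) u (vtx (next i))) (trans (cong vtx (prev-next i)) vi) (joins (next i))

    FigEdge? : ∀ v → B.Decidable (FigEdge W v)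
    FigEdge? v a b = any? (λ i → (vtx i ≟ v) ×-dec
      (((edg i ≟ a) ×-dec (edg (next i) ≟ b)) ⊎-dec ((edg i ≟ b) ×-dec (edg (next i) ≟ a))))

    FigReach⇒Star : ∀ {v a c} → FigReach W v a c → Star (FigEdge W v) a c
    FigReach⇒Star here       = ε
    FigReach⇒Star (step e r) = e ◅ FigReach⇒Star r

    Star⇒FigReach : ∀ {v a c} → Star (FigEdge W v) a c → FigReach W v a c
    Star⇒FigReach ε       = here
    Star⇒FigReach (e ◅ s) = step e (Star⇒FigReach s)

    FigReach? : ∀ v a → Decidable (FigReach W v a)
    FigReach? v a c = map′ Star⇒FigReach FigReach⇒Star (Star? (FigEdge? v) a c)

    FigClosed : Fin n → Pred (Fin m) 0ℓ → Set
    FigClosed v C = ∀ {c d} → FigEdge W v c d → C c → C d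

    FigReach-figClosed : ∀ {v a} → FigClosed v (FigReach W v a)
    FigReach-figClosed e here       = step e here
    FigReach-figClosed e (step e' r) = step e' (FigReach-figClosed e r)

    FigClosed-transport : ∀ {v C a b} → FigClosed v C → FigReach W v a b → C a → C b
    FigClosed-transport closed here       Ca = Ca
    FigClosed-transport closed (step e r) Ca = FigClosed-transport closed r (closed e Ca)

    Repetition⇔FigClosed : ∀ {v N C} → Corresponds v N C → Repetition W v N ⇔ FigClosed v C
    Repetition⇔FigClosed {v} {N} {C} corr = mk⇔ figClosed repetition
      where
        passage : Repetition W v N → ∀ i → vtx i ≡ v → C (edg i) ⇔ C (edg (next i))
        passage rep i vi = corr (Joins-next vi) ⇔-∘ (⇔-sym (rep i vi) ⇔-∘ ⇔-sym (corr (Joins-prev vi)))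

        figClosed : Repetition W v N → FigClosed v C
        figClosed rep (i , vi , inj₁ (refl , refl)) = to   (passage rep i vi)
        figClosed rep (i , vi , inj₂ (refl , refl)) = from (passage rep i vi)

        repetition : FigClosed v C → Repetition W v N
        repetition closed i vi =
          ⇔-sym (corr (Joins-prev vi))
            ⇔-∘ (mk⇔ (closed (i , vi , inj₂ (refl , refl))) (closed (i , vi , inj₁ (refl , refl)))
            ⇔-∘ corr (Joins-next vi))

    componentEnds-repetition : ∀ v a → Repetition W v (farEnds v (FigReach? v a))
    componentEnds-repetition v a =
      from (Repetition⇔FigClosed (farEnds-corresponds v (FigReach? v a))) FigReach-figClosed

    NoNontrivialRepetition : Set
    NoNontrivialRepetition =
      ∀ v (N : Subset n) → (∀ x → x ∈ N → Adj G v x) → Repetition W v N → Trivial W v N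

    -- The far ends of the edges in the component of a form a repetition containing
    -- the far end of a; if it is all of N(v), it contains the far end of b.
    noNontrivialRepetition⇒figureConnected : NoNontrivialRepetition → ∀ v → FigureConnected W v
    noNontrivialRepetition⇒figureConnected trivial v a b ia ib with FigReach? v a b
    ... | yes a⇝b = a⇝b
    ... | no ¬a⇝b = ⊥-elim $
      [ (λ empty → let (x , ja) = Incident⇒Joins ia in empty x (from (corr ja) here))
      , (λ full  → let (y , jb) = Incident⇒Joins ib in ¬a⇝b (to (corr jb) (from (full y) (b , jb))))
      ]′ (trivial v _ (farEnds⊆neighbours v (FigReach? v a)) (componentEnds-repetition v a))
      where corr = farEnds-corresponds v (FigReach? v a)

    figureConnected⇒noNontrivialRepetition : (∀ v → FigureConnected W v) → NoNontrivialRepetition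
    figureConnected⇒noNontrivialRepetition connected v N N⊆N[v] rep with any? (_∈? N)
    ... | no ∄x∈N        = inj₁ (λ x x∈N → ∄x∈N (x , x∈N))
    ... | yes (x , x∈N) = inj₂ (λ y → mk⇔ (N⊆N[v] y) (λ (b , jb) → y∈N jb))
      where
        corr : Corresponds v N (EdgesInto v N)
        corr = EdgesInto-corresponds
        a : Fin m
        a = proj₁ (N⊆N[v] x x∈N)
        ja : Joins G a v x
        ja = proj₂ (N⊆N[v] x x∈N)
        y∈N : ∀ {b y} → Joins G b v y → y ∈ N
        y∈N jb = from (corr jb)
          (FigClosed-transport (to (Repetition⇔FigClosed corr) rep)
            (connected v a _ (Joins⇒Incident ja) (Joins⇒Incident jb))
            (to (corr ja) x∈N))

proposition3p3 : (G : Graph) → Connected G → (W : ClosedWalk G) → DoubleTrace W →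
                 (StrongTrace W ⇔ (∀ v → FigureConnected W v))
proposition3p3 G _ W doubleTrace = mk⇔
  (noNontrivialRepetition⇒figureConnected W ∘ proj₂)
  (λ connected → doubleTrace , figureConnected⇒noNontrivialRepetition W connected)
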